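{- Let $T=(T_1,T_2,\ldots)$ be a standard tower tableau and let $c$ be the cell labelled $1$, contained in the tower $T_i$ for some $i\ge 1$ (equivalently $c=(i,0)$). Then $|T_i|>|T_{i+1}|$, where $|T_t|$ denotes the number of cells of the tower $T_t$.
   Context: A tower diagram is a finite sequence $\mathcal T=(\mathcal T_1,\mathcal T_2,\ldots)$ of towers; the $i$-th tower of size $k_i\ge 0$ consists of the unit cells $(i,0),(i,1),\ldots,(i,k_i-1)$, where the cell $(i,j)$ is the unit square $[i-1,i]\times[j,j+1]$ of the first quadrant, identified with its south-east corner; the cell $(i,j)$ lies on the diagonal $x+y=i+j$. Sliding. For a positive integer $a$ and a tail $(\mathcal T_p,\mathcal T_{p+1},\ldots)$ of a tower diagram (towers keep their absolute positions), $a^{\searrow}(\mathcal T_p,\ldots)$ either adds exactly one cell or terminates without result, as follows. (S1) If no tower $\mathcal T_t$, $t\ge p$, has a cell on the diagonal $x+y=a-1$: (a) if no such tower has a cell on $x+y=a$, add the cell $(a,0)$; (b) if $(a,0)\in\mathcal T_a$ and $(a,1)\notin\mathcal T_a$, terminate; (c) if $(a,0),(a,1)\in\mathcal T_a$, the result is $(a+1)^{\searrow}(\mathcal T_{a+1},\ldots)$, terminating iff that does. (S2) Otherwise let $\mathcal T_i$, $i\ge p$, be the leftmost such tower with a cell on $x+y=a-1$, namely $(i,a-1-i)$: (a) if $(i,a-i)\notin\mathcal T_i$, add $(i,a-i)$; (b) if $(i,a-i)\in\mathcal T_i$ but $(i,a-i+1)\notin\mathcal T_i$, terminate; (c) if both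 lie in $\mathcal T_i$, the result is $(a+1)^{\searrow}(\mathcal T_{i+1},\ldots)$, terminating iff that does. Sliding $a$ into $\mathcal T$ means $a^{\searrow}(\mathcal T_1,\mathcal T_2,\ldots)$. A standard tower tableau is obtained by sliding a word $\alpha_1\cdots\alpha_n$ of positive integers letter by letter into the empty diagram, no step terminating, and labelling the cell created by the $k$-th letter by $k$; the word is its reading word. -}

module Defs where

open import Data.Nat using (ℕ; zero; suc; _∸_; _<_; _<?_)
open import Data.Product using (_×_; _,_)
open import Data.List using (List; []; _∷_; length; _++_; [_])
open import Data.Maybe using (Maybe; just; nothing)
open import Relation.Nullary using (yes; no)

-- A tower diagram is a list of tower sizes (k₁, k₂, …); towers beyond the
-- end of the list have size 0.  Towers are indexed from 1.
TowerDiagram : Set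
TowerDiagram = List ℕ

-- A cell (i , j) is the cell of tower i at height j.
Cell : Set
Cell = ℕ × ℕ

size : TowerDiagram → ℕ → ℕ
size []      _             = 0
size (k ∷ D) zero          = 0
size (k ∷ D) (suc zero)    = k
size (k ∷ D) (suc (suc t)) = size D (suc t)

setSize : TowerDiagram → ℕ → ℕ → TowerDiagram
setSize D       zero          m = D
setSize []      (suc zero)    m = m ∷ []
setSize (k ∷ D) (suc zero)    m = m ∷ D
setSize []      (suc (suc t)) m = 0 ∷ setSize [] (suc t) m
setSize (k ∷ D) (suc (suc t)) m = k ∷ setSize D (suc t) m

addCell : TowerDiagram → Cell → TowerDiagram
addCell D (i , j) = setSize D i (suc j)

-- leftmost tower t with t ≥ p (scanning n candidates t = p, p+1, …)
-- having a cell on the diagonal x + y = d, i.e. (t , d ∸ t) ∈ T_t.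
scan : TowerDiagram → ℕ → ℕ → ℕ → Maybe ℕ
scan D d t zero    = nothing
scan D d t (suc n) with d ∸ t <? size D t
... | yes _ = just t
... | no  _ = scan D d (suc t) n

-- leftmost tower T_t, t ≥ p, with a cell on the diagonal x + y = d
-- (such a tower necessarily has t ≤ d)
leftmostOn : TowerDiagram → ℕ → ℕ → Maybe ℕ
leftmostOn D d p = scan D d p (suc d ∸ p)

-- a^↘(T_p, T_{p+1}, …) : returns the cell to be added, or nothing when
-- sliding terminates without result.  The fuel argument only serves
-- termination checking; each recursive call (cases (c)) strictly passes a
-- nonempty tower, so fuel  suc (length D)  is never exhausted.
slideF : ℕ → TowerDiagram → ℕ → ℕ → Maybe Cell
slideF zero    D p a = nothing
slideF (suc f) D p a with leftmostOn D (a ∸ 1) p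
... | nothing with leftmostOn D a p
...   | nothing = just (a , 0)
...   | just _ with 0 <? size D a | 1 <? size D a
...     | yes _ | no  _ = nothing
...     | yes _ | yes _ = slideF f D (suc a) (suc a)
...     | no  _ | _     = nothing                    -- impossible case
slideF (suc f) D p a | just i with a ∸ i <? size D i | suc (a ∸ i) <? size D i
... | no  _ | _     = just (i , a ∸ i)
... | yes _ | no  _ = nothing
... | yes _ | yes _ = slideF f D (suc i) (suc a)

slide : TowerDiagram → ℕ → Maybe Cell
slide D a = slideF (suc (length D)) D 1 a

-- slide the remaining word letter by letter into D, recording the created
-- cells in order (the k-th entry is the cell labelled k).  Returns nothing
-- if some step terminates without result.
runWord : TowerDiagram → List Cell → List ℕ → Maybe (TowerDiagram × List Cell)
runWord D cs []      = just (D , cs)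
runWord D cs (a ∷ w) with slide D a
... | nothing = nothing
... | just c  = runWord (addCell D c) (cs ++ [ c ]) w

-- the standard tower tableau with reading word w (if it exists):
-- its shape together with the list of cells in label order 1, 2, …, n
tableauOf : List ℕ → Maybe (TowerDiagram × List Cell)
tableauOf w = runWord [] [] w

-- Sliding the first letter a into the empty diagram creates (a , 0), so
-- afterwards |T_a| = 1 > 0 = |T_{a+1}|.  Every later slide keeps
-- |T_a| > |T_{a+1}|: the cells added are always on top of a tower, and a cell
-- (a+1 , h) is only added when (a , h+1) ∈ T_a.  Indeed, if the scan finding
-- tower a+1 for the letter b started at or left of a, then tower a misses the
-- diagonal x + y = b - 1, impossible since T_a is nonempty and reaches every
-- diagonal that T_{a+1} reaches; otherwise the scan was restarted right after
-- tower a by case (c), which requires that very cell.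
module Submission where

open import Defs
open import Data.Nat using (ℕ; zero; suc; _<_; _≤_; _+_; _∸_; s≤s; z<s; _<?_)
open import Data.Nat.Properties
open import Data.Product using (_×_; _,_)
open import Data.Sum using (_⊎_; inj₁; inj₂)
open import Data.List using (List; []; _∷_; _++_; [_])
open import Data.List.Relation.Unary.All using (All; []; _∷_)
open import Data.Maybe using (just; nothing)
open import Function using (_∘_)
open import Relation.Nullary using (yes; no; ¬_; contradiction)
open import Relation.Binary.PropositionalEquality
  using (_≡_; refl; sym; trans; cong; subst; subst₂; _≢_)

size-0 : ∀ D → size D 0 ≡ 0
size-0 []      = refl
size-0 (_ ∷ _) = refl

size-setSize-self : ∀ D t m → size (setSize D (suc t) m) (suc t) ≡ m
size-setSize-self []      zero    m = refl
size-setSize-self (_ ∷ _) zero    m = refl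
size-setSize-self []      (suc t) m = size-setSize-self [] t m
size-setSize-self (_ ∷ D) (suc t) m = size-setSize-self D t m

size-setSize-other : ∀ D t m s → s ≢ t → size (setSize D t m) s ≡ size D s
size-setSize-other D       zero          m s             _   = refl
size-setSize-other D       (suc t)       m zero          _   =
  trans (size-0 (setSize D (suc t) m)) (sym (size-0 D))
size-setSize-other D       (suc zero)    m (suc zero)    s≢t = contradiction refl s≢t
size-setSize-other []      (suc zero)    m (suc (suc s)) _   = refl
size-setSize-other (_ ∷ _) (suc zero)    m (suc (suc s)) _   = refl
size-setSize-other []      (suc (suc t)) m (suc zero)    _   = refl
size-setSize-other (_ ∷ _) (suc (suc t)) m (suc zero)    _   = refl
size-setSize-other []      (suc (suc t)) m (suc (suc s)) s≢t =
  size-setSize-other [] (suc t) m (suc s) (s≢t ∘ cong suc)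
size-setSize-other (_ ∷ D) (suc (suc t)) m (suc (suc s)) s≢t =
  size-setSize-other D (suc t) m (suc s) (s≢t ∘ cong suc)

Reaches : TowerDiagram → ℕ → ℕ → Set
Reaches D d t = d ∸ t < size D t

scan-just : ∀ {D d} t n {i} → scan D d t n ≡ just i →
  t ≤ i × i < t + n × Reaches D d i × (∀ s → t ≤ s → s < i → ¬ Reaches D d s)
scan-just {D} {d} t (suc n) {i} eq with d ∸ t <? size D t
scan-just t (suc n) refl | yes reach =
  ≤-refl , m<m+n t z<s , reach , λ s t≤s s<t → contradiction t≤s (<⇒≱ s<t)
... | no ¬reach with scan-just (suc t) n eq
... | t<i , i<t+n , reach , before =
  <⇒≤ t<i , subst (i <_) (sym (+-suc t n)) i<t+n , reach , before′
  where
  before′ : ∀ s → t ≤ s → s < i → ¬ Reaches D d s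
  before′ s t≤s s<i with t ≟ s
  ... | yes refl = ¬reach
  ... | no t≢s = before s (≤∧≢⇒< t≤s t≢s) s<i

scan-nothing : ∀ {D d} t n → scan D d t n ≡ nothing →
  ∀ s → t ≤ s → s < t + n → ¬ Reaches D d s
scan-nothing t zero _ s t≤s s<t+0 =
  contradiction t≤s (<⇒≱ (subst (s <_) (+-identityʳ t) s<t+0))
scan-nothing {D} {d} t (suc n) eq s t≤s s<t+n with d ∸ t <? size D t
... | no ¬reach with t ≟ s
...   | yes refl = ¬reach
...   | no t≢s   =
  scan-nothing (suc t) n eq s (≤∧≢⇒< t≤s t≢s) (subst (s <_) (+-suc t n) s<t+n)

scan-[] : ∀ d t n → scan [] d t n ≡ nothing
scan-[] d t zero    = refl
scan-[] d t (suc n) = scan-[] d (suc t) n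

leftmostOn-just : ∀ {D d p i} → leftmostOn D d p ≡ just i →
  p ≤ i × i ≤ d × Reaches D d i × (∀ s → p ≤ s → s < i → ¬ Reaches D d s)
leftmostOn-just {d = d} {p} {i} eq with scan-just p (suc d ∸ p) eq
... | p≤i , i<bound , reach , before = p≤i , m<1+n⇒m≤n i<1+d , reach , before
  where
  i<1+d : i < suc d
  i<1+d with p ≤? suc d
  ... | yes p≤1+d = subst (i <_) (m+[n∸m]≡n p≤1+d) i<bound
  ... | no p≰1+d  = contradiction p≤i (<⇒≱ (subst (i <_)
          (trans (cong (p +_) (m≤n⇒m∸n≡0 (<⇒≤ (≰⇒> p≰1+d)))) (+-identityʳ p)) i<bound))

leftmostOn-nothing : ∀ {D d p} → leftmostOn D d p ≡ nothing →
  ∀ s → p ≤ s → s ≤ d → ¬ Reaches D d s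
leftmostOn-nothing {d = d} {p} eq s p≤s s≤d =
  scan-nothing p (suc d ∸ p) eq s p≤s
    (subst (s <_) (sym (m+[n∸m]≡n (≤-trans p≤s (m≤n⇒m≤1+n s≤d)))) (s≤s s≤d))

Descent : ℕ → TowerDiagram → Set
Descent a D = size D (suc a) < size D a

¬descent-0 : ∀ D → ¬ Descent 0 D
¬descent-0 D desc = contradiction (subst (size D 1 <_) (size-0 D) desc) λ ()

m∸n≤1+m∸[1+n] : ∀ m n → m ∸ n ≤ suc (m ∸ suc n)
m∸n≤1+m∸[1+n] zero    n       = m≤n⇒m≤1+n (m∸n≤m 0 n)
m∸n≤1+m∸[1+n] (suc m) zero    = ≤-refl
m∸n≤1+m∸[1+n] (suc m) (suc n) = m∸n≤1+m∸[1+n] m n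

descent-reaches : ∀ {a D} d → Descent a D → Reaches D d (suc a) → Reaches D d a
descent-reaches {a} d desc reach = <-≤-trans (s≤s (≤-trans (m∸n≤1+m∸[1+n] d a) reach)) desc

Admissible : ℕ → TowerDiagram → Cell → Set
Admissible a D (t , h) = (t ≡ a → size D a ≤ h) × (t ≡ suc a → suc h < size D a)

descent-addCell : ∀ {a D t h} → Descent a D → Admissible a D (t , h) →
  Descent a (addCell D (t , h))
descent-addCell {zero} {D} desc _ = contradiction desc (¬descent-0 D)
descent-addCell {suc a} {D} {t} {h} desc (below , left-of) with t ≟ suc a | t ≟ suc (suc a)
... | yes refl | _ =
  subst₂ _<_ (sym (size-setSize-other D t (suc h) (suc t) (λ ())))
             (sym (size-setSize-self D a (suc h)))
             (<-≤-trans desc (m≤n⇒m≤1+n (below refl)))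
... | no _ | yes refl =
  subst₂ _<_ (sym (size-setSize-self D (suc a) (suc h)))
             (sym (size-setSize-other D t (suc h) (suc a) (λ ())))
             (left-of refl)
... | no t≢a | no t≢1+a =
  subst₂ _<_ (sym (size-setSize-other D t (suc h) (suc (suc a)) (t≢1+a ∘ sym)))
             (sym (size-setSize-other D t (suc h) (suc a) (t≢a ∘ sym)))
             desc

-- Invariant of the calls b^↘(T_p, …) made while sliding a letter: a call
-- starting just right of tower a comes from case (c) at tower a, so that
-- (a , b - a) ∈ T_a.
SlideStart : ℕ → TowerDiagram → ℕ → ℕ → Set
SlideStart a D p b = p ≤ b × (p ≡ suc a → suc (b ∸ suc a) < size D a)

≤1+n⇒≤n⊎≡1+n : ∀ {m n} → m ≤ suc n → m ≤ n ⊎ m ≡ suc n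
≤1+n⇒≤n⊎≡1+n m≤1+n with m≤n⇒m<n∨m≡n m≤1+n
... | inj₁ m<1+n = inj₁ (m<1+n⇒m≤n m<1+n)
... | inj₂ m≡1+n = inj₂ m≡1+n

s1a-admissible : ∀ {a D p b} → Descent a D → SlideStart a D p b →
  leftmostOn D (b ∸ 1) p ≡ nothing → leftmostOn D b p ≡ nothing →
  Admissible a D (b , 0)
s1a-admissible {a} {D} {p} {b} desc (p≤b , start) none-below none-on = below , left-of
  where
  below : b ≡ a → size D a ≤ 0
  below refl = subst (size D b ≤_) (n∸n≡0 b)
    (≮⇒≥ (leftmostOn-nothing {D} {b} {p} none-on b p≤b ≤-refl))
  left-of : b ≡ suc a → 1 < size D a
  left-of refl with ≤1+n⇒≤n⊎≡1+n p≤b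
  ... | inj₁ p≤a = contradiction (subst (_< size D a) (sym (n∸n≡0 a)) (<-≤-trans z<s desc))
                                 (leftmostOn-nothing {D} {a} {p} none-below a p≤a ≤-refl)
  ... | inj₂ refl = subst (λ x → suc x < size D a) (n∸n≡0 a) (start refl)

s2a-admissible : ∀ {a D p b i} → Descent a D → SlideStart a D p b →
  leftmostOn D (b ∸ 1) p ≡ just i → ¬ Reaches D b i →
  Admissible a D (i , b ∸ i)
s2a-admissible {a} {D} {p} {b} {i} desc (_ , start) first ¬reach = below , left-of
  where
  below : i ≡ a → size D a ≤ b ∸ i
  below refl = ≮⇒≥ ¬reach
  left-of : i ≡ suc a → suc (b ∸ i) < size D a
  left-of refl with leftmostOn-just {D} {b ∸ 1} {p} first
  ... | p≤i , _ , reach , before with ≤1+n⇒≤n⊎≡1+n {p} {a} p≤i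
  ...   | inj₁ p≤a =
    contradiction (descent-reaches {D = D} (b ∸ 1) desc reach) (before a p≤a ≤-refl)
  ...   | inj₂ refl = start refl

s1c-start : ∀ {a D b} → 1 < size D b → SlideStart a D (suc b) (suc b)
s1c-start {D = D} {b} two-cells =
  ≤-refl , λ { refl → subst (λ x → suc x < size D b) (sym (n∸n≡0 b)) two-cells }

s2c-start : ∀ {a D p b i} → leftmostOn D (b ∸ 1) p ≡ just i → suc (b ∸ i) < size D i →
  SlideStart a D (suc i) (suc b)
s2c-start {D = D} {p} {b} first two-cells with leftmostOn-just {D} {b ∸ 1} {p} first
... | _ , i≤b-1 , _ = s≤s (≤-trans i≤b-1 (m∸n≤m b 1)) , λ { refl → two-cells }

slideF-admissible : ∀ f {a D p b c} → Descent a D → SlideStart a D p b →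
  slideF f D p b ≡ just c → Admissible a D c
slideF-admissible (suc f) {D = D} {p} {b} desc start eq with leftmostOn D (b ∸ 1) p in below
... | just i with b ∸ i <? size D i | suc (b ∸ i) <? size D i
...   | no ¬reach | _ with refl ← eq = s2a-admissible {D = D} {p} {b} desc start below ¬reach
...   | yes _ | yes two-cells =
  slideF-admissible f desc (s2c-start {D = D} {p} {b} below two-cells) eq
slideF-admissible (suc f) {D = D} {p} {b} desc start eq | nothing with leftmostOn D b p in on
...   | nothing with refl ← eq = s1a-admissible {D = D} {p} {b} desc start below on
...   | just _ with 0 <? size D b | 1 <? size D b
...     | yes _ | yes two-cells = slideF-admissible f desc (s1c-start {D = D} two-cells) eq

slide-admissible : ∀ {a D b c} → Descent a D → 0 < b →
  slide D b ≡ just c → Admissible a D c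
slide-admissible {D = D} desc 0<b =
  slideF-admissible _ desc (0<b , λ { refl → contradiction desc (¬descent-0 D) })

slide-[] : ∀ a → slide [] a ≡ just (a , 0)
slide-[] a rewrite scan-[] (a ∸ 1) 1 (a ∸ 1) | scan-[] a 1 a = refl

runWord-head : ∀ w {D c₀ cs₀ T c cs} →
  runWord D (c₀ ∷ cs₀) w ≡ just (T , c ∷ cs) → c₀ ≡ c
runWord-head []      refl = refl
runWord-head (b ∷ w) {D} {cs₀ = cs₀} eq with slide D b
... | just c = runWord-head w {cs₀ = cs₀ ++ [ c ]} eq

runWord-descent : ∀ {a} w → All (0 <_) w → ∀ {D cs T cs′} → Descent a D →
  runWord D cs w ≡ just (T , cs′) → Descent a T
runWord-descent []      []           desc refl = desc
runWord-descent (b ∷ w) (0<b ∷ pos) {D} desc eq with slide D b in slid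
... | just c = runWord-descent w pos (descent-addCell desc (slide-admissible desc 0<b slid)) eq

descent-singleton : ∀ a → Descent (suc a) (addCell [] (suc a , 0))
descent-singleton a =
  subst₂ _<_ (sym (size-setSize-other [] (suc a) 1 (suc (suc a)) (λ ())))
             (sym (size-setSize-self [] a 1))
             z<s

lemma1 : (w : List ℕ) → All (0 <_) w →
    (T : TowerDiagram) (c : Cell) (cs : List Cell) →
    tableauOf w ≡ just (T , c ∷ cs) →
    (i j : ℕ) → c ≡ (i , j) →
    size T (suc i) < size T i
lemma1 (suc a ∷ w) (_ ∷ pos) T c cs eq i j refl
  rewrite slide-[] (suc a)
  with refl ← runWord-head w eq = runWord-descent w pos (descent-singleton a) eq
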